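{- Every connected $X$-graph has a turning Euler cycle.
   Context: Graphs are finite and may have multiple edges and loops. A half-edge of a graph is a pair consisting of an edge and one of its end vertices (a loop contributes two half-edges at its vertex). An $X$-graph is a graph in which every vertex has degree $4$, together with, for each vertex, a fixed partition of the four half-edges at that vertex into two pairs. An Euler cycle is a closed walk traversing every edge exactly once. An Euler cycle in an $X$-graph is turning if at each passage through each vertex, the half-edge by which it enters the vertex and the half-edge by which it leaves belong to different pairs of the partition at that vertex. -}

module Defs where

open import Data.Nat using (ℕ; zero; suc)
open import Data.Nat.DivMod using (_%_; m%n<n)
open import Data.Fin using (Fin; zero; suc; toℕ; fromℕ<)
open import Data.Product using (Σ; _×_; _,_; proj₁; proj₂)
open import Relation.Binary.PropositionalEquality using (_≡_)
open import Relation.Nullary using (¬_)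
open import Function.Bundles using (_↔_)
open import Function.Definitions using (Bijective)

other : Fin 2 → Fin 2
other zero = suc zero
other (suc zero) = zero

-- A finite multigraph (loops and multiple edges allowed) with vertex set
-- Fin n and edge set Fin m.  A loop thus gives two half-edges at
-- its vertex.
record Graph : Set where
  field
    n   : ℕ
    m   : ℕ
    end : Fin m → Fin 2 → Fin n

  HalfEdge : Set
  HalfEdge = Fin m × Fin 2

  at : HalfEdge → Fin n
  at (e , s) = end e s

  Dart : Set
  Dart = Fin m × Fin 2

  tail : Dart → Fin n
  tail (e , s) = end e s

  head : Dart → Fin n
  head (e , s) = end e (other s)

  outHE : Dart → HalfEdge
  outHE (e , s) = (e , s)

  inHE : Dart → HalfEdge
  inHE (e , s) = (e , other s)

  data Walk : Fin n → Fin n → Set where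
    nil  : ∀ {v} → Walk v v
    cons : ∀ {u w} (d : Dart) → tail d ≡ u → Walk (head d) w → Walk u w

  Connected : Set
  Connected = Fin n × ((u v : Fin n) → Walk u v)

-- An X-graph: every vertex has degree 4, with the four half-edges at each
-- vertex partitioned into two pairs.  The partition is given by a label
-- cls h ∈ Fin 2 of each half-edge h (which pair at its vertex it lies in),
-- such that at every vertex v each of the two classes contains exactly two
-- half-edges attached at v (hence v has exactly four half-edges, degree 4).
record XGraph : Set where
  field
    graph : Graph
  open Graph graph public
  field
    cls   : HalfEdge → Fin 2
    pairs : (v : Fin n) (c : Fin 2) →
            Fin 2 ↔ Σ HalfEdge (λ h → at h ≡ v × cls h ≡ c)

next : ∀ {k} → Fin (suc k) → Fin (suc k)
next {k} i = fromℕ< (m%n<n (suc (toℕ i)) (suc k))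

module _ (X : XGraph) where
  open XGraph X

  record TurningEulerCycle : Set where
    field
      k      : ℕ
      m≡     : m ≡ suc k
      walk   : Fin (suc k) → Dart
      closed : (i : Fin (suc k)) → head (walk i) ≡ tail (walk (next i))
      euler  : Bijective {A = Fin (suc k)} _≡_ _≡_ (λ i → proj₁ (walk i))
      turning : (i : Fin (suc k)) →
                ¬ (cls (inHE (walk i)) ≡ cls (outHE (walk (next i))))

-- Hierholzer's algorithm for turning trails.  A turning circuit uses, at
-- every vertex, as many half-edges of one pair as of the other.  As each pair
-- has exactly two half-edges, a turning trail on unused edges that leaves a
-- vertex through one pair can always be continued until it re-enters that
-- vertex through the other pair, closing into a turning circuit.  Starting
-- such a trail at a vertex of a circuit that still has an unused half-edge
-- and splicing it in lengthens the circuit; by connectivity such a vertex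
-- exists as long as some edge is unused.
module Submission where

open import Defs
open import Algebra.Properties.CommutativeSemigroup using (interchange)
open import Axiom.UniquenessOfIdentityProofs using (module Decidable⇒UIP)
open import Data.Empty using (⊥-elim)
open import Data.Fin using (Fin; zero; suc; toℕ)
import Data.Fin.Properties as Fin
open import Data.List using (List; []; _∷_; _++_; map; length; lookup)
open import Data.List.Properties using (++-identityʳ)
open import Data.List.Membership.Propositional using (_∈_; _∉_)
open import Data.List.Membership.Propositional.Properties
  using (∈-map⁺; ∈-map⁻; ∈-lookup; ∈-∃++)
import Data.List.Relation.Unary.All as All
open import Data.List.Relation.Unary.All.Properties using (¬Any⇒All¬)
open import Data.List.Relation.Unary.Any using (here; there; index)
open import Data.List.Relation.Unary.Any.Properties using (lookup-index)
open import Data.List.Relation.Unary.AllPairs using ([]; _∷_)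
open import Data.List.Relation.Unary.Unique.Propositional using (Unique)
open import Data.List.Relation.Binary.Permutation.Propositional
  using (_↭_; ↭-sym; ↭⇒↭ₛ)
open import Data.List.Relation.Binary.Permutation.Propositional.Properties
  using (++-comm; ∈-resp-↭; ↭-length) renaming (map⁺ to ↭-map⁺)
import Data.List.Relation.Binary.Permutation.Setoid.Properties as Setoid↭
open import Data.Nat using (ℕ; zero; suc; _+_; _∸_; _≤_; _<_; _<?_; z≤n; s≤s)
open import Data.Nat.DivMod using (_%_; m<n⇒m%n≡m; n%n≡0)
open import Data.Nat.Properties
  using ( ≤-refl; ≤-antisym; ≤-pred; <-≤-trans; ≮⇒≥; m<n⇒m<1+n; suc-injective; ∸-monoʳ-<
        ; +-comm; +-identityʳ; +-mono-≤; +-monoʳ-≤; +-cancelʳ-≡; +-commutativeSemigroup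
        ; module ≤-Reasoning )
open import Data.Nat.Tactic.RingSolver using (solve-∀)
open import Data.Product using (Σ; ∃; ∃₂; _×_; _,_; proj₁; proj₂)
open import Data.Product.Properties using (≡-dec)
open import Data.Sum using (_⊎_; inj₁; inj₂; [_,_]′)
open import Function using (_∘_)
open import Function.Bundles using (Inverse; Injection)
open import Function.Properties.Inverse using (Inverse⇒Injection)
open import Relation.Binary.Definitions using (DecidableEquality)
open import Relation.Binary.PropositionalEquality
open import Relation.Nullary using (¬_; Dec; yes; no)

𝟙 : {P : Set} → Dec P → ℕ
𝟙 (yes _) = 1
𝟙 (no _)  = 0

𝟙-yes : {P : Set} (d : Dec P) → P → 𝟙 d ≡ 1
𝟙-yes (yes _) _ = refl
𝟙-yes (no ¬p) p = ⊥-elim (¬p p)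

𝟙-no : {P : Set} (d : Dec P) → ¬ P → 𝟙 d ≡ 0
𝟙-no (yes p) ¬p = ⊥-elim (¬p p)
𝟙-no (no _)  _  = refl

𝟙≤1 : {P : Set} (d : Dec P) → 𝟙 d ≤ 1
𝟙≤1 (yes _) = s≤s z≤n
𝟙≤1 (no _)  = z≤n

𝟙-cong : {P Q : Set} (p : Dec P) (q : Dec Q) → (P → Q) → (Q → P) → 𝟙 p ≡ 𝟙 q
𝟙-cong (yes p) q to _    = sym (𝟙-yes q (to p))
𝟙-cong (no ¬p) q _  from = sym (𝟙-no q (¬p ∘ from))

𝟙-disjoint-⊎ : {P Q R : Set} (p : Dec P) (q : Dec Q) (r : Dec R) →
               (P → ¬ Q) → (R → P ⊎ Q) → (P ⊎ Q → R) → 𝟙 r ≡ 𝟙 p + 𝟙 q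
𝟙-disjoint-⊎ (yes p) (yes q) _ disjoint _ _ = ⊥-elim (disjoint p q)
𝟙-disjoint-⊎ (yes p) (no _)  r _ _ join = 𝟙-yes r (join (inj₁ p))
𝟙-disjoint-⊎ (no _)  (yes q) r _ _ join = 𝟙-yes r (join (inj₂ q))
𝟙-disjoint-⊎ (no ¬p) (no ¬q) r _ split _ = 𝟙-no r ([ ¬p , ¬q ]′ ∘ split)

other-≢ : ∀ c → other c ≢ c
other-≢ zero ()
other-≢ (suc zero) ()

other-involutive : ∀ c → other (other c) ≡ c
other-involutive zero       = refl
other-involutive (suc zero) = refl

≢⇒other : ∀ {c d} → c ≢ d → other c ≡ d
≢⇒other {zero}     {zero}     c≢d = ⊥-elim (c≢d refl)
≢⇒other {zero}     {suc zero} _   = refl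
≢⇒other {suc zero} {zero}     _   = refl
≢⇒other {suc zero} {suc zero} c≢d = ⊥-elim (c≢d refl)

+-interchange : ∀ a b c d → (a + b) + (c + d) ≡ (a + c) + (b + d)
+-interchange = interchange +-commutativeSemigroup

next-suc : ∀ {k} (i : Fin (suc k)) → toℕ i < k → toℕ (next i) ≡ suc (toℕ i)
next-suc i i<k = trans (Fin.toℕ-fromℕ< _) (m<n⇒m%n≡m (s≤s i<k))

next-last : ∀ {k} (i : Fin (suc k)) → toℕ i ≡ k → next i ≡ zero
next-last {k} i i≡k = Fin.toℕ-injective (begin
  toℕ (next i)           ≡⟨ Fin.toℕ-fromℕ< _ ⟩
  suc (toℕ i) % suc k    ≡⟨ cong (λ j → suc j % suc k) i≡k ⟩
  suc k % suc k          ≡⟨ n%n≡0 (suc k) ⟩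
  0                      ∎)
  where open ≡-Reasoning

module _ {S G : Set} (size : S → ℕ) {bound : ℕ} (size≤bound : ∀ s → size s ≤ bound)
         (step : (s : S) → G ⊎ Σ S (λ s′ → size s < size s′)) where

  iterate : S → G
  iterate s = go (bound ∸ size s) s ≤-refl
    where
    go : ∀ k s → bound ∸ size s ≤ k → G
    go k s gap≤k with step s
    ... | inj₁ g = g
    ... | inj₂ (s′ , s<s′) = continue k (<-≤-trans (∸-monoʳ-< s<s′ (size≤bound s′)) gap≤k)
      where
      continue : ∀ k → bound ∸ size s′ < k → G
      continue zero    ()
      continue (suc k) gap<1+k = go k s′ (≤-pred gap<1+k)

data Chain {A : Set} (R : A → A → Set) : A → A → List A → Set where
  [_] : ∀ x → Chain R x x (x ∷ [])
  _◅_ : ∀ {x y z xs} → R x y → Chain R y z xs → Chain R x z (x ∷ xs)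

Cyclic : {A : Set} → (A → A → Set) → List A → Set
Cyclic R xs = ∃₂ λ a z → Chain R a z xs × R z a

module _ {A : Set} {R : A → A → Set} where

  chain-head : ∀ {a z x xs} → Chain R a z (x ∷ xs) → a ≡ x
  chain-head [ _ ]   = refl
  chain-head (_ ◅ _) = refl

  chain-head∈ : ∀ {a z xs} → Chain R a z xs → a ∈ xs
  chain-head∈ [ _ ]   = here refl
  chain-head∈ (_ ◅ _) = here refl

  chain-++ : ∀ {a b c d xs ys} → Chain R a b xs → R b c → Chain R c d ys → Chain R a d (xs ++ ys)
  chain-++ [ _ ]      r ch₂ = r ◅ ch₂
  chain-++ (r′ ◅ ch₁) r ch₂ = r′ ◅ chain-++ ch₁ r ch₂

  chain-++⁻ : ∀ x xs y ys {a d} → Chain R a d ((x ∷ xs) ++ (y ∷ ys)) →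
              ∃ λ b → Chain R a b (x ∷ xs) × R b y × Chain R y d (y ∷ ys)
  chain-++⁻ x [] y ys (r ◅ ch) with chain-head ch
  ... | refl = x , [ x ] , r , ch
  chain-++⁻ x (x′ ∷ xs) y ys (r ◅ ch) with chain-++⁻ x′ xs y ys ch
  ... | b , ch₁ , r′ , ch₂ = b , r ◅ ch₁ , r′ , ch₂

  length-chain-++ : ∀ {a z xs} ys → Chain R a z xs → length ys < length (xs ++ ys)
  length-chain-++ ys [ _ ]    = ≤-refl
  length-chain-++ ys (_ ◅ ch) = m<n⇒m<1+n (length-chain-++ ys ch)

  chain-lookup-suc : ∀ {a z xs} → Chain R a z xs → ∀ i j → toℕ j ≡ suc (toℕ i) →
                     R (lookup xs i) (lookup xs j)
  chain-lookup-suc (r ◅ [ _ ])   zero    (suc zero) _  = r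
  chain-lookup-suc (r ◅ (_ ◅ _)) zero    (suc zero) _  = r
  chain-lookup-suc (_ ◅ ch)      (suc i) (suc j)    eq = chain-lookup-suc ch i j (suc-injective eq)
  chain-lookup-suc (_ ◅ (_ ◅ _)) zero    (suc (suc _)) ()
  chain-lookup-suc [ _ ]         zero    zero       ()
  chain-lookup-suc (_ ◅ _)       zero    zero       ()
  chain-lookup-suc (_ ◅ _)       (suc _) zero       ()

  chain-lookup-last : ∀ {a z xs} → Chain R a z xs → ∀ i → suc (toℕ i) ≡ length xs → lookup xs i ≡ z
  chain-lookup-last [ _ ]         zero    _  = refl
  chain-lookup-last (_ ◅ [ _ ])   zero    ()
  chain-lookup-last (_ ◅ (_ ◅ _)) zero    ()
  chain-lookup-last (_ ◅ ch)      (suc i) eq = chain-lookup-last ch i (suc-injective eq)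

  chain-successor : ∀ {a z x xs} → Chain R a z xs → x ∈ xs → x ≡ z ⊎ ∃ λ y → y ∈ xs × R x y
  chain-successor [ _ ]    (here refl) = inj₁ refl
  chain-successor [ _ ]    (there ())
  chain-successor (r ◅ ch) (here refl) = inj₂ (_ , there (chain-head∈ ch) , r)
  chain-successor (_ ◅ ch) (there x∈) with chain-successor ch x∈
  ... | inj₁ x≡z             = inj₁ x≡z
  ... | inj₂ (y , y∈ , x~y)  = inj₂ (y , there y∈ , x~y)

  cyclic-successor : ∀ {x xs} → Cyclic R xs → x ∈ xs → ∃ λ y → y ∈ xs × R x y
  cyclic-successor (a , z , ch , z~a) x∈ with chain-successor ch x∈
  ... | inj₁ refl = a , chain-head∈ ch , z~a
  ... | inj₂ succ = succ

  cyclic-++-comm : ∀ xs ys → Cyclic R (xs ++ ys) → Cyclic R (ys ++ xs)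
  cyclic-++-comm [] ys cyc rewrite ++-identityʳ ys = cyc
  cyclic-++-comm (x ∷ xs) [] cyc rewrite ++-identityʳ (x ∷ xs) = cyc
  cyclic-++-comm (x ∷ xs) (y ∷ ys) (a , z , ch , z~a) with chain-++⁻ x xs y ys ch
  ... | b , ch₁ , b~y , ch₂ = y , b , chain-++ ch₂ z~a ch₁ , b~y

  cyclic-rotate : ∀ {x xs} → Cyclic R xs → x ∈ xs →
                  ∃₂ λ z ys → Chain R x z (x ∷ ys) × R z x × (x ∷ ys) ↭ xs
  cyclic-rotate {x} cyc x∈ with ∈-∃++ x∈
  ... | ys , zs , refl with cyclic-++-comm ys (x ∷ zs) cyc
  ...   | a , z , ch , z~a with chain-head ch
  ...     | refl = z , zs ++ ys , ch , z~a , ++-comm (x ∷ zs) ys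

  cyclic-lookup : ∀ {a z x xs} → Chain R a z (x ∷ xs) → R z a →
                  ∀ i → R (lookup (x ∷ xs) i) (lookup (x ∷ xs) (next i))
  cyclic-lookup {xs = xs} ch z~a i with toℕ i <? length xs
  ... | yes i<last = chain-lookup-suc ch i (next i) (next-suc i i<last)
  ... | no  i≮last = subst₂ R (sym (chain-lookup-last ch i (cong suc i≡last)))
                               (trans (chain-head ch) (cong (lookup _) (sym (next-last i i≡last))))
                               z~a
    where
    i≡last : toℕ i ≡ length xs
    i≡last = ≤-antisym (≤-pred (Fin.toℕ<n i)) (≮⇒≥ i≮last)

Unique-resp-↭ : {A : Set} {xs ys : List A} → xs ↭ ys → Unique xs → Unique ys
Unique-resp-↭ {A} = Setoid↭.Unique-resp-↭ (setoid A) ∘ ↭⇒↭ₛ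

module _ {A : Set} {m : ℕ} (f : A → Fin m) where

  lookup-injective : ∀ {xs} → Unique (map f xs) →
                     ∀ {i j} → f (lookup xs i) ≡ f (lookup xs j) → i ≡ j
  lookup-injective {_ ∷ _}  (_ ∷ _)    {zero}  {zero}  _  = refl
  lookup-injective {_ ∷ _}  (fx∉ ∷ _)  {zero}  {suc j} eq = ⊥-elim (All.lookup fx∉ (∈-map⁺ f (∈-lookup j)) eq)
  lookup-injective {_ ∷ _}  (fx∉ ∷ _)  {suc i} {zero}  eq = ⊥-elim (All.lookup fx∉ (∈-map⁺ f (∈-lookup i)) (sym eq))
  lookup-injective {_ ∷ _}  (_ ∷ uniq) {suc i} {suc j} eq = cong suc (lookup-injective uniq eq)

  ∈-map⇒lookup : ∀ {xs e} → e ∈ map f xs → ∃ λ i → f (lookup xs i) ≡ e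
  ∈-map⇒lookup e∈ with ∈-map⁻ f e∈
  ... | x , x∈ , refl = index x∈ , cong f (sym (lookup-index x∈))

  unique⇒length≤ : ∀ {xs} → Unique (map f xs) → length xs ≤ m
  unique⇒length≤ uniq = Fin.injective⇒≤ (lookup-injective uniq)

  covering⇒length≥ : ∀ {xs} → (∀ e → e ∈ map f xs) → m ≤ length xs
  covering⇒length≥ {xs} covers = Fin.injective⇒≤ λ {e} {e′} eq →
    trans (sym (proj₂ (position e))) (trans (cong (f ∘ lookup xs) eq) (proj₂ (position e′)))
    where
    position : ∀ e → ∃ λ i → f (lookup xs i) ≡ e
    position e = ∈-map⇒lookup (covers e)

module TurningTrails (X : XGraph) where
  open XGraph X

  open import Data.List.Membership.DecPropositional (Fin._≟_ {m}) using (_∈?_)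

  edge : HalfEdge → Fin m
  edge = proj₁

  edges : List Dart → List (Fin m)
  edges = map edge

  Port : Set
  Port = Fin n × Fin 2

  _≟ᵖ_ : DecidableEquality Port
  _≟ᵖ_ = ≡-dec Fin._≟_ Fin._≟_

  _≟ʰ_ : DecidableEquality HalfEdge
  _≟ʰ_ = ≡-dec Fin._≟_ Fin._≟_

  port : HalfEdge → Port
  port h = at h , cls h

  opposite : Port → Port
  opposite (u , c) = u , other c

  opposite-involutive : ∀ p → opposite (opposite p) ≡ p
  opposite-involutive (u , c) = cong (u ,_) (other-involutive c)

  opposite-≢ : ∀ p → opposite p ≢ p
  opposite-≢ (u , c) eq = other-≢ c (cong proj₂ eq)

  inPort outPort : Dart → Port
  inPort  = port ∘ inHE
  outPort = port ∘ outHE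

  infix 4 _↝_
  _↝_ : Dart → Dart → Set
  d ↝ d′ = head d ≡ tail d′ × cls (inHE d) ≢ cls (outHE d′)

  ↝-intro : ∀ {d d′} → inPort d ≡ opposite (outPort d′) → d ↝ d′
  ↝-intro eq = cong proj₁ eq , λ same → other-≢ _ (trans (sym (cong proj₂ eq)) same)

  ↝-resp-outPort : ∀ {c d d′} → outPort d ≡ outPort d′ → c ↝ d → c ↝ d′
  ↝-resp-outPort eq (head≡tail , turns) =
    trans head≡tail (cong proj₁ eq) , λ same → turns (trans same (sym (cong proj₂ eq)))

  slot : Port → Fin 2 → HalfEdge
  slot (u , c) i = proj₁ (Inverse.to (pairs u c) i)

  port-slot : ∀ p i → port (slot p i) ≡ p
  port-slot (u , c) i = cong₂ _,_ at≡ cls≡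
    where
    at≡ = proj₁ (proj₂ (Inverse.to (pairs u c) i))
    cls≡ = proj₂ (proj₂ (Inverse.to (pairs u c) i))

  slot-injective : ∀ p {i j} → slot p i ≡ slot p j → i ≡ j
  slot-injective (u , c) eq = Injection.injective (Inverse⇒Injection (pairs u c)) (fibre-≡ eq)
    where
    fibre-≡ : {x y : Σ HalfEdge λ h → at h ≡ u × cls h ≡ c} → proj₁ x ≡ proj₁ y → x ≡ y
    fibre-≡ {h , a , b} {.h , a′ , b′} refl = cong₂ (λ a b → h , a , b)
      (Decidable⇒UIP.≡-irrelevant Fin._≟_ a a′) (Decidable⇒UIP.≡-irrelevant Fin._≟_ b b′)

  slot-surjective : ∀ {p} h → port h ≡ p → ∃ λ i → slot p i ≡ h
  slot-surjective {u , c} h refl =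
    Inverse.from (pairs u c) (h , refl , refl) ,
    cong proj₁ (Inverse.strictlyInverseˡ (pairs u c) (h , refl , refl))

  𝟙-port : ∀ h p → 𝟙 (port h ≟ᵖ p) ≡ 𝟙 (h ≟ʰ slot p zero) + 𝟙 (h ≟ʰ slot p (suc zero))
  𝟙-port h p = 𝟙-disjoint-⊎ (h ≟ʰ slot p zero) (h ≟ʰ slot p (suc zero)) (port h ≟ᵖ p) distinct split join
    where
    distinct : h ≡ slot p zero → h ≢ slot p (suc zero)
    distinct refl eq with slot-injective p eq
    ... | ()
    split : port h ≡ p → h ≡ slot p zero ⊎ h ≡ slot p (suc zero)
    split eq with slot-surjective h eq
    ... | zero     , slot≡h = inj₁ (sym slot≡h)
    ... | suc zero , slot≡h = inj₂ (sym slot≡h)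
    join : h ≡ slot p zero ⊎ h ≡ slot p (suc zero) → port h ≡ p
    join (inj₁ refl) = port-slot p zero
    join (inj₂ refl) = port-slot p (suc zero)

  𝟙-edge : ∀ d h → 𝟙 (edge h Fin.≟ edge d) ≡ 𝟙 (inHE d ≟ʰ h) + 𝟙 (outHE d ≟ʰ h)
  𝟙-edge (e , s) (e′ , t) =
    𝟙-disjoint-⊎ ((e , other s) ≟ʰ (e′ , t)) ((e , s) ≟ʰ (e′ , t)) (e′ Fin.≟ e) distinct split join
    where
    distinct : (e , other s) ≡ (e′ , t) → (e , s) ≢ (e′ , t)
    distinct refl eq = other-≢ s (sym (cong proj₂ eq))
    split : e′ ≡ e → (e , other s) ≡ (e′ , t) ⊎ (e , s) ≡ (e′ , t)
    split refl with s Fin.≟ t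
    ... | yes refl = inj₂ refl
    ... | no  s≢t  = inj₁ (cong (e ,_) (≢⇒other s≢t))
    join : (e , other s) ≡ (e′ , t) ⊎ (e , s) ≡ (e′ , t) → e′ ≡ e
    join (inj₁ refl) = refl
    join (inj₂ refl) = refl

  𝟙-port-opposite : ∀ q p → 𝟙 (q ≟ᵖ p) + 𝟙 (opposite q ≟ᵖ p) ≡ 𝟙 (proj₁ q Fin.≟ proj₁ p)
  𝟙-port-opposite (u , c) (v , d) =
    sym (𝟙-disjoint-⊎ ((u , c) ≟ᵖ (v , d)) ((u , other c) ≟ᵖ (v , d)) (u Fin.≟ v) distinct split join)
    where
    distinct : (u , c) ≡ (v , d) → (u , other c) ≢ (v , d)
    distinct refl eq = other-≢ c (cong proj₂ eq)
    split : u ≡ v → (u , c) ≡ (v , d) ⊎ (u , other c) ≡ (v , d)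
    split refl with c Fin.≟ d
    ... | yes refl = inj₁ refl
    ... | no  c≢d  = inj₂ (cong (u ,_) (≢⇒other c≢d))
    join : (u , c) ≡ (v , d) ⊎ (u , other c) ≡ (v , d) → u ≡ v
    join (inj₁ refl) = refl
    join (inj₂ refl) = refl

  load : List (Fin m) → Port → ℕ
  load E p = 𝟙 (edge (slot p zero) ∈? E) + 𝟙 (edge (slot p (suc zero)) ∈? E)

  load≤2 : ∀ E p → load E p ≤ 2
  load≤2 E p = +-mono-≤ (𝟙≤1 (edge (slot p zero) ∈? E)) (𝟙≤1 (edge (slot p (suc zero)) ∈? E))

  load-resp-↭ : ∀ {E E′} → E ↭ E′ → ∀ p → load E p ≡ load E′ p
  load-resp-↭ {E} {E′} E↭E′ p = cong₂ _+_ (same (edge (slot p zero))) (same (edge (slot p (suc zero))))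
    where
    same : ∀ x → 𝟙 (x ∈? E) ≡ 𝟙 (x ∈? E′)
    same x = 𝟙-cong (x ∈? E) (x ∈? E′) (∈-resp-↭ E↭E′) (∈-resp-↭ (↭-sym E↭E′))

  -- Double counting of the incidences between the two half-edges of edge d
  -- and the two slots of p.
  load-∷ : ∀ {E} d p → edge d ∉ E →
           load (edge d ∷ E) p ≡ (𝟙 (inPort d ≟ᵖ p) + 𝟙 (outPort d ≟ᵖ p)) + load E p
  load-∷ {E} d p d∉E = begin
      load (edge d ∷ E) p
    ≡⟨ cong₂ _+_ (𝟙-∈-∷ (edge s₀)) (𝟙-∈-∷ (edge s₁)) ⟩
      (𝟙 (edge s₀ Fin.≟ edge d) + 𝟙 (edge s₀ ∈? E)) + (𝟙 (edge s₁ Fin.≟ edge d) + 𝟙 (edge s₁ ∈? E))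
    ≡⟨ +-interchange (𝟙 (edge s₀ Fin.≟ edge d)) _ (𝟙 (edge s₁ Fin.≟ edge d)) _ ⟩
      (𝟙 (edge s₀ Fin.≟ edge d) + 𝟙 (edge s₁ Fin.≟ edge d)) + load E p
    ≡⟨ cong (_+ load E p) (cong₂ _+_ (𝟙-edge d s₀) (𝟙-edge d s₁)) ⟩
      ((𝟙 (inHE d ≟ʰ s₀) + 𝟙 (outHE d ≟ʰ s₀)) + (𝟙 (inHE d ≟ʰ s₁) + 𝟙 (outHE d ≟ʰ s₁))) + load E p
    ≡⟨ cong (_+ load E p) (+-interchange (𝟙 (inHE d ≟ʰ s₀)) _ (𝟙 (inHE d ≟ʰ s₁)) _) ⟩
      ((𝟙 (inHE d ≟ʰ s₀) + 𝟙 (inHE d ≟ʰ s₁)) + (𝟙 (outHE d ≟ʰ s₀) + 𝟙 (outHE d ≟ʰ s₁))) + load E p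
    ≡⟨ cong (_+ load E p) (sym (cong₂ _+_ (𝟙-port (inHE d) p) (𝟙-port (outHE d) p))) ⟩
      (𝟙 (inPort d ≟ᵖ p) + 𝟙 (outPort d ≟ᵖ p)) + load E p
    ∎
    where
    open ≡-Reasoning
    s₀ = slot p zero
    s₁ = slot p (suc zero)
    𝟙-∈-∷ : ∀ x → 𝟙 (x ∈? (edge d ∷ E)) ≡ 𝟙 (x Fin.≟ edge d) + 𝟙 (x ∈? E)
    𝟙-∈-∷ x = 𝟙-disjoint-⊎ (x Fin.≟ edge d) (x ∈? E) (x ∈? (edge d ∷ E)) (λ { refl x∈E → d∉E x∈E }) split join
      where
      split : x ∈ edge d ∷ E → x ≡ edge d ⊎ x ∈ E
      split (here x≡d)  = inj₁ x≡d
      split (there x∈E) = inj₂ x∈E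
      join : x ≡ edge d ⊎ x ∈ E → x ∈ edge d ∷ E
      join (inj₁ x≡d)  = here x≡d
      join (inj₂ x∈E) = there x∈E

  free-slot : ∀ {E p} → load E p ≤ 1 → ∃ λ i → edge (slot p i) ∉ E
  free-slot {E} {p} = go (edge (slot p zero) ∈? E) (edge (slot p (suc zero)) ∈? E)
    where
    go : (d₀ : Dec (edge (slot p zero) ∈ E)) (d₁ : Dec (edge (slot p (suc zero)) ∈ E)) →
         𝟙 d₀ + 𝟙 d₁ ≤ 1 → ∃ λ i → edge (slot p i) ∉ E
    go (no ∉E) _        _         = zero , ∉E
    go (yes _) (no ∉E)  _         = suc zero , ∉E
    go (yes _) (yes _)  (s≤s ())

  unused⇒load≤1 : ∀ {E p} h → port h ≡ p → edge h ∉ E → load E p ≤ 1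
  unused⇒load≤1 {E} {p} h port≡p h∉E with slot-surjective h port≡p
  ... | zero , refl rewrite 𝟙-no (edge h ∈? E) h∉E = 𝟙≤1 _
  ... | suc zero , refl rewrite 𝟙-no (edge h ∈? E) h∉E = subst (_≤ 1) (sym (+-identityʳ _)) (𝟙≤1 _)

  Balanced : List (Fin m) → Set
  Balanced E = ∀ p → load E p ≡ load E (opposite p)

  -- The load of an open trail's edges E together with its two loose ends:
  -- the port a through which the next dart has to enter, and the port b
  -- through which the trail must eventually leave to close up.
  load⁺ : List (Fin m) → Port → Port → Port → ℕ
  load⁺ E a b p = load E p + (𝟙 (a ≟ᵖ p) + 𝟙 (b ≟ᵖ p))

  OpenBalanced : List (Fin m) → Port → Port → Set
  OpenBalanced E a b = ∀ p → load⁺ E a b p ≡ load⁺ E a b (opposite p)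

  load⁺-closed : ∀ E b p → load⁺ E (opposite b) b p ≡ load E p + 𝟙 (proj₁ b Fin.≟ proj₁ p)
  load⁺-closed E b p = cong (load E p +_)
    (trans (+-comm (𝟙 (opposite b ≟ᵖ p)) (𝟙 (b ≟ᵖ p))) (𝟙-port-opposite b p))

  balanced⇒openBalanced : ∀ E b → Balanced E → OpenBalanced E (opposite b) b
  balanced⇒openBalanced E b balanced p = begin
    load⁺ E (opposite b) b p                               ≡⟨ load⁺-closed E b p ⟩
    load E p + 𝟙 (proj₁ b Fin.≟ proj₁ p)                  ≡⟨ cong (_+ 𝟙 (proj₁ b Fin.≟ proj₁ p)) (balanced p) ⟩
    load E (opposite p) + 𝟙 (proj₁ b Fin.≟ proj₁ p)       ≡⟨ load⁺-closed E b (opposite p) ⟨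
    load⁺ E (opposite b) b (opposite p)                    ∎
    where open ≡-Reasoning

  openBalanced⇒balanced : ∀ E b → OpenBalanced E (opposite b) b → Balanced E
  openBalanced⇒balanced E b openBalanced p = +-cancelʳ-≡ _ _ (load E (opposite p)) (begin
    load E p + 𝟙 (proj₁ b Fin.≟ proj₁ p)                  ≡⟨ load⁺-closed E b p ⟨
    load⁺ E (opposite b) b p                               ≡⟨ openBalanced p ⟩
    load⁺ E (opposite b) b (opposite p)                    ≡⟨ load⁺-closed E b (opposite p) ⟩
    load E (opposite p) + 𝟙 (proj₁ b Fin.≟ proj₁ p)       ∎)
    where open ≡-Reasoning

  -- d fills the loose end a, and the units at outPort d and at the new loose
  -- end opposite (outPort d) raise both pairs at tail d equally.
  openBalanced-∷ : ∀ E {a b} d → edge d ∉ E → inPort d ≡ a → OpenBalanced E a b →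
                   OpenBalanced (edge d ∷ E) (opposite (outPort d)) b
  openBalanced-∷ E {a} {b} d d∉E refl openBalanced p = begin
      load⁺ (edge d ∷ E) (opposite (outPort d)) b p
    ≡⟨ shift p ⟩
      load⁺ E a b p + 𝟙 (tail d Fin.≟ proj₁ p)
    ≡⟨ cong (_+ 𝟙 (tail d Fin.≟ proj₁ p)) (openBalanced p) ⟩
      load⁺ E a b (opposite p) + 𝟙 (tail d Fin.≟ proj₁ p)
    ≡⟨ shift (opposite p) ⟨
      load⁺ (edge d ∷ E) (opposite (outPort d)) b (opposite p)
    ∎
    where
    open ≡-Reasoning
    regroup : ∀ i o o′ x l → ((i + o) + l) + (o′ + x) ≡ (l + (i + x)) + (o + o′)
    regroup = solve-∀
    shift : ∀ q → load⁺ (edge d ∷ E) (opposite (outPort d)) b q ≡ load⁺ E a b q + 𝟙 (tail d Fin.≟ proj₁ q)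
    shift q = begin
        load (edge d ∷ E) q + (𝟙 (opposite (outPort d) ≟ᵖ q) + 𝟙 (b ≟ᵖ q))
      ≡⟨ cong (_+ (𝟙 (opposite (outPort d) ≟ᵖ q) + 𝟙 (b ≟ᵖ q))) (load-∷ d q d∉E) ⟩
        ((𝟙 (a ≟ᵖ q) + 𝟙 (outPort d ≟ᵖ q)) + load E q) + (𝟙 (opposite (outPort d) ≟ᵖ q) + 𝟙 (b ≟ᵖ q))
      ≡⟨ regroup (𝟙 (a ≟ᵖ q)) (𝟙 (outPort d ≟ᵖ q)) (𝟙 (opposite (outPort d) ≟ᵖ q)) (𝟙 (b ≟ᵖ q)) (load E q) ⟩
        load⁺ E a b q + (𝟙 (outPort d ≟ᵖ q) + 𝟙 (opposite (outPort d) ≟ᵖ q))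
      ≡⟨ cong (load⁺ E a b q +_) (𝟙-port-opposite (outPort d) q) ⟩
        load⁺ E a b q + 𝟙 (tail d Fin.≟ proj₁ q)
      ∎

  -- The loose end a adds one unit at a but none at opposite a, and a port
  -- holds only two half-edges.
  demand-free : ∀ E {a b} → OpenBalanced E a b → opposite a ≢ b → load E a ≤ 1
  demand-free E {a} {b} openBalanced opposite-a≢b = ≤-pred (begin
    suc (load E a)                              ≡⟨ +-comm 1 (load E a) ⟩
    load E a + 1                                ≤⟨ +-monoʳ-≤ (load E a) one≤ ⟩
    load⁺ E a b a                               ≡⟨ openBalanced a ⟩
    load⁺ E a b (opposite a)                    ≡⟨ cong (load E (opposite a) +_) no-ends ⟩
    load E (opposite a) + 0                     ≡⟨ +-identityʳ _ ⟩
    load E (opposite a)                         ≤⟨ load≤2 E (opposite a) ⟩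
    2                                           ∎)
    where
    open ≤-Reasoning
    one≤ : 1 ≤ 𝟙 (a ≟ᵖ a) + 𝟙 (b ≟ᵖ a)
    one≤ rewrite 𝟙-yes (a ≟ᵖ a) refl = s≤s z≤n
    no-ends : 𝟙 (a ≟ᵖ opposite a) + 𝟙 (b ≟ᵖ opposite a) ≡ 0
    no-ends = cong₂ _+_ (𝟙-no (a ≟ᵖ opposite a) (opposite-≢ a ∘ sym))
                        (𝟙-no (b ≟ᵖ opposite a) (opposite-a≢b ∘ sym))

  unused-at⇒load≤1 : ∀ {E p} h → Balanced E → at h ≡ proj₁ p → edge h ∉ E → load E p ≤ 1
  unused-at⇒load≤1 {E} {u , c} h balanced refl h∉E with cls h Fin.≟ c
  ... | yes refl = unused⇒load≤1 h refl h∉E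
  ... | no  c≢   = subst (_≤ 1) (sym (balanced (u , c)))
                     (unused⇒load≤1 h (cong (u ,_) (sym (≢⇒other (c≢ ∘ sym)))) h∉E)

  enteringThrough : HalfEdge → Dart
  enteringThrough (e , s) = e , other s

  inHE-enteringThrough : ∀ h → inHE (enteringThrough h) ≡ h
  inHE-enteringThrough (e , s) = cong (e ,_) (other-involutive s)

  fresh-dart : ∀ E {a} → load E a ≤ 1 → ∃ λ d → inPort d ≡ a × edge d ∉ E
  fresh-dart E {a} load≤1 with free-slot load≤1
  ... | i , unused =
    enteringThrough (slot a i) ,
    trans (cong port (inHE-enteringThrough (slot a i))) (port-slot a i) ,
    unused

  -- A turning trail in front of the darts C, built by prepending darts.  It
  -- ends by entering through opposite b, so it closes up once its first
  -- dart leaves through b.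
  record Trail (C : List Dart) (b : Port) : Set where
    field
      darts        : List Dart
      first last   : Dart
      chain        : Chain _↝_ first last darts
      last-enters  : inPort last ≡ opposite b
      unique       : Unique (edges (darts ++ C))
      openBalanced : OpenBalanced (edges (darts ++ C)) (opposite (outPort first)) b

  Closes : ∀ {C b} → Trail C b → Set
  Closes {b = b} t = outPort (Trail.first t) ≡ b

  closed-balanced : ∀ {C b} (t : Trail C b) → Closes t → Balanced (edges (Trail.darts t ++ C))
  closed-balanced {C} {b} t closes = openBalanced⇒balanced E b
    (subst (λ a → OpenBalanced E a b) (cong opposite closes) (Trail.openBalanced t))
    where E = edges (Trail.darts t ++ C)

  closed-cyclic : ∀ {C b} (t : Trail C b) → Closes t → Cyclic _↝_ (Trail.darts t)
  closed-cyclic t closes =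
    first , last , chain , ↝-intro (trans last-enters (cong opposite (sym closes)))
    where open Trail t

  singleton-trail : ∀ {C b} → Unique (edges C) → Balanced (edges C) →
                    ∀ d → inPort d ≡ opposite b → edge d ∉ edges C → Trail C b
  singleton-trail {C} {b} uniqueC balancedC d enters d∉C = record
    { darts        = d ∷ []
    ; first        = d
    ; last         = d
    ; chain        = [ d ]
    ; last-enters  = enters
    ; unique       = ¬Any⇒All¬ _ d∉C ∷ uniqueC
    ; openBalanced = openBalanced-∷ (edges C) d d∉C enters (balanced⇒openBalanced (edges C) b balancedC)
    }

  prepend : ∀ {C b} (t : Trail C b) d → inPort d ≡ opposite (outPort (Trail.first t)) →
            edge d ∉ edges (Trail.darts t ++ C) → Trail C b
  prepend {C} t d enters d∉ = record
    { darts        = d ∷ darts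
    ; first        = d
    ; last         = last
    ; chain        = ↝-intro enters ◅ chain
    ; last-enters  = last-enters
    ; unique       = ¬Any⇒All¬ _ d∉ ∷ unique
    ; openBalanced = openBalanced-∷ (edges (darts ++ C)) d d∉ enters openBalanced
    }
    where open Trail t

  closing-trail : ∀ {C b} → Unique (edges C) → Balanced (edges C) → load (edges C) (opposite b) ≤ 1 →
                  Σ (Trail C b) Closes
  closing-trail {C} {b} uniqueC balancedC load≤1 with fresh-dart (edges C) load≤1
  ... | d , enters , d∉C = iterate size (λ t → unique⇒length≤ edge (Trail.unique t)) step
                                   (singleton-trail uniqueC balancedC d enters d∉C)
    where
    size : Trail C b → ℕ
    size t = length (Trail.darts t ++ C)
    step : (t : Trail C b) → Σ (Trail C b) Closes ⊎ Σ (Trail C b) λ t′ → size t < size t′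
    step t with outPort (Trail.first t) ≟ᵖ b
    ... | yes closes = inj₁ (t , closes)
    ... | no  open′  with fresh-dart E (demand-free E (Trail.openBalanced t) demand≢b)
      where
      E = edges (Trail.darts t ++ C)
      demand≢b : opposite (opposite (outPort (Trail.first t))) ≢ b
      demand≢b = open′ ∘ trans (sym (opposite-involutive _))
    ...   | d′ , enters′ , d′∉ = inj₂ (prepend t d′ enters′ d′∉ , ≤-refl)

  record Circuit : Set where
    field
      darts    : List Dart
      cyclic   : Cyclic _↝_ darts
      unique   : Unique (edges darts)
      balanced : Balanced (edges darts)

  Visits : List Dart → Fin n → Set
  Visits C w = ∃ λ d → d ∈ C × tail d ≡ w

  Junction : List Dart → Set
  Junction C = ∃ λ w → Visits C w × ∃ λ h → at h ≡ w × edge h ∉ edges C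

  endpoints-visited : ∀ {C} → Cyclic _↝_ C → ∀ {e} → e ∈ edges C → ∀ s → Visits C (end e s)
  endpoints-visited cyclic e∈ s with ∈-map⁻ edge e∈
  ... | (e , t) , d∈ , refl with t Fin.≟ s
  ...   | yes refl = (e , s) , d∈ , refl
  ...   | no  t≢s with cyclic-successor cyclic d∈
  ...     | d′ , d′∈ , head≡tail , _ = d′ , d′∈ , trans (sym head≡tail) (cong (end e) (≢⇒other t≢s))

  junction-on-walk : ∀ {C u v} → (∀ {e} → e ∈ edges C → ∀ s → Visits C (end e s)) →
                     Walk u v → Visits C u → (∃ λ h → at h ≡ v × edge h ∉ edges C) → Junction C
  junction-on-walk _ nil visits-u (h , at≡ , h∉) = _ , visits-u , h , at≡ , h∉
  junction-on-walk {C} endpoints (cons d tail≡u walk) visits-u target with edge d ∈? edges C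
  ... | yes d∈ = junction-on-walk endpoints walk (endpoints d∈ (other (proj₂ d))) target
  ... | no  d∉ = _ , visits-u , outHE d , tail≡u , d∉

  junction : ∀ {C e} → (∀ u v → Walk u v) → Cyclic _↝_ C → e ∉ edges C → Junction C
  junction {e = e} connected cyclic@(a , _ , chain , _) e∉ =
    junction-on-walk (endpoints-visited cyclic) (connected (tail a) (end e zero))
                     (a , chain-head∈ chain , refl) ((e , zero) , refl , e∉)

  splice-cyclic : ∀ {d z ds} → Chain _↝_ d z (d ∷ ds) → z ↝ d →
                  (t : Trail (d ∷ ds) (outPort d)) → Closes t → Cyclic _↝_ (Trail.darts t ++ d ∷ ds)
  splice-cyclic chain′ z↝d t closes =
    first , _ , chain-++ chain (↝-intro last-enters) chain′ , ↝-resp-outPort (sym closes) z↝d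
    where open Trail t

  splice : (C : Circuit) → Junction (Circuit.darts C) →
           Σ Circuit λ C′ → length (Circuit.darts C) < length (Circuit.darts C′)
  splice record { darts = ds ; cyclic = cyclic ; unique = unique ; balanced = balanced }
         (w , (d , d∈ , tail≡w) , h , at≡w , h∉)
    with cyclic-rotate cyclic d∈
  ... | z , ds′ , chain′ , z↝d , rotation = spliced , growth
    where
    perm : edges (d ∷ ds′) ↭ edges ds
    perm = ↭-map⁺ edge rotation
    balanced′ : Balanced (edges (d ∷ ds′))
    balanced′ p = trans (load-resp-↭ perm p) (trans (balanced p) (sym (load-resp-↭ perm (opposite p))))
    free : load (edges (d ∷ ds′)) (opposite (outPort d)) ≤ 1
    free = unused-at⇒load≤1 h balanced′ (trans at≡w (sym tail≡w)) (h∉ ∘ ∈-resp-↭ perm)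
    closing = closing-trail (Unique-resp-↭ (↭-sym perm) unique) balanced′ free
    t = proj₁ closing
    spliced : Circuit
    spliced = record
      { darts    = Trail.darts t ++ d ∷ ds′
      ; cyclic   = splice-cyclic chain′ z↝d t (proj₂ closing)
      ; unique   = Trail.unique t
      ; balanced = closed-balanced t (proj₂ closing)
      }
    growth : length ds < length (Trail.darts t ++ d ∷ ds′)
    growth = subst (_< length (Trail.darts t ++ d ∷ ds′)) (↭-length rotation)
                   (length-chain-++ (d ∷ ds′) (Trail.chain t))

  Eulerian : Circuit → Set
  Eulerian C = ∀ e → e ∈ edges (Circuit.darts C)

  grow : (∀ u v → Walk u v) → (C : Circuit) →
         Σ Circuit Eulerian ⊎ Σ Circuit λ C′ → length (Circuit.darts C) < length (Circuit.darts C′)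
  grow connected C with Fin.all? (λ e → e ∈? edges (Circuit.darts C))
  ... | yes covers    = inj₁ (C , covers)
  ... | no  uncovered = inj₂ (splice C (junction connected (Circuit.cyclic C) (proj₂ unused)))
    where unused = Fin.¬∀⟶∃¬ m _ (λ e → e ∈? edges (Circuit.darts C)) uncovered

  initial-circuit : Fin n → Circuit
  initial-circuit v with closing-trail {[]} {v , zero} [] (λ _ → refl) z≤n
  ... | t , closes = record
      { darts    = darts ++ []
      ; cyclic   = subst (Cyclic _↝_) (sym (++-identityʳ darts)) (closed-cyclic t closes)
      ; unique   = unique
      ; balanced = closed-balanced t closes
      }
    where open Trail t

  eulerian-circuit : Graph.Connected graph → Σ Circuit Eulerian
  eulerian-circuit (v , connected) =
    iterate (length ∘ Circuit.darts) (λ C → unique⇒length≤ edge (Circuit.unique C)) (grow connected)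
            (initial-circuit v)

  cyclic⇒turningEulerCycle : ∀ {ds} → Cyclic _↝_ ds → Unique (edges ds) → (∀ e → e ∈ edges ds) →
                             TurningEulerCycle X
  cyclic⇒turningEulerCycle {[]} (_ , _ , () , _)
  cyclic⇒turningEulerCycle {d ∷ ds} (_ , _ , chain , z↝a) unique covers = record
    { k       = length ds
    ; m≡      = ≤-antisym (covering⇒length≥ edge {d ∷ ds} covers) (unique⇒length≤ edge {d ∷ ds} unique)
    ; walk    = lookup (d ∷ ds)
    ; closed  = λ i → proj₁ (cyclic-lookup chain z↝a i)
    ; euler   = lookup-injective edge unique , surjective
    ; turning = λ i → proj₂ (cyclic-lookup chain z↝a i)
    }
    where
    surjective : ∀ e → ∃ λ i → ∀ {j} → j ≡ i → edge (lookup (d ∷ ds) j) ≡ e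
    surjective e with ∈-map⇒lookup edge (covers e)
    ... | i , edge≡e = i , λ { refl → edge≡e }

mainTheorem2 : (X : XGraph) → Graph.Connected (XGraph.graph X) → TurningEulerCycle X
mainTheorem2 X connected = cyclic⇒turningEulerCycle cyclic unique covers
  where
  open TurningTrails X
  eulerian = eulerian-circuit connected
  open Circuit (proj₁ eulerian)
  covers = proj₂ eulerian
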